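{- Let $h$ be the morphism on $\{0,1,2\}^*$ defined by $h(0)=01$, $h(1)=21$, $h(2)=0$, and let $\mathbf{p}$ be the infinite fixed point of $h$ beginning with $0$. Let $F=\{00,11,22,20,212,0101,02102,121012,01021010,21021012102\}$ and let $L$ be the language of all cube-free words over $\{0,1,2\}$ having no factor in $F$. Then $L$ characterizes $\mathbf{p}$: every finite factor of $\mathbf{p}$ belongs to $L$, and every recurrent factor of an infinite word all of whose finite factors lie in $L$ is a factor of $\mathbf{p}$.
   Context: A word is cube-free if it has no factor of the form $xxx$ with $x$ nonempty. A factor of an infinite word is recurrent if it occurs infinitely often in it. -}

module Defs where

open import Data.Nat using (ℕ; zero; suc; _≥_)
open import Data.Fin using (Fin; zero; suc)
open import Data.List using (List; []; _∷_; _++_; concatMap; length)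
open import Data.Product using (∃; ∃-syntax; _×_; Σ-syntax)
open import Relation.Binary.PropositionalEquality using (_≡_)
open import Relation.Nullary using (¬_)

Letter : Set
Letter = Fin 3

pattern a0 = zero
pattern a1 = suc zero
pattern a2 = suc (suc zero)

Word : Set
Word = List Letter

InfWord : Set
InfWord = ℕ → Letter

hL : Letter → Word
hL a0 = a0 ∷ a1 ∷ []
hL a1 = a2 ∷ a1 ∷ []
hL a2 = a0 ∷ []

h : Word → Word
h = concatMap hL

hIter : ℕ → Word → Word
hIter zero w = w
hIter (suc k) w = h (hIter k w)

-- n-th letter of a finite word (default a0 if out of range; never used
-- out of range below since |h^(n+1)(0)| ≥ n+1)
at : Word → ℕ → Letter
at [] _ = a0
at (x ∷ xs) zero = x
at (x ∷ xs) (suc n) = at xs n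

-- the fixed point p = lim h^k(0): its n-th letter is the n-th letter of h^(n+1)(0)
-- (h^k(0) is a prefix of h^(k+1)(0) and |h^k(0)| ≥ k+1)
p : InfWord
p n = at (hIter (suc n) (a0 ∷ [])) n

FactorOf : Word → Word → Set
FactorOf u w = ∃[ x ] ∃[ y ] (w ≡ x ++ u ++ y)

slice : InfWord → ℕ → ℕ → Word
slice x i zero = []
slice x i (suc n) = x i ∷ slice x (suc i) n

OccursAt : Word → InfWord → ℕ → Set
OccursAt u x i = slice x i (length u) ≡ u

Factor : Word → InfWord → Set
Factor u x = ∃[ i ] OccursAt u x i

Recurrent : Word → InfWord → Set
Recurrent u x = ∀ N → ∃[ i ] (i ≥ N × OccursAt u x i)

CubeFree : Word → Set
CubeFree w = ∀ (u : Word) → ¬ (u ≡ []) → ¬ FactorOf (u ++ u ++ u) w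

F : List Word
F = (a0 ∷ a0 ∷ [])
  ∷ (a1 ∷ a1 ∷ [])
  ∷ (a2 ∷ a2 ∷ [])
  ∷ (a2 ∷ a0 ∷ [])
  ∷ (a2 ∷ a1 ∷ a2 ∷ [])
  ∷ (a0 ∷ a1 ∷ a0 ∷ a1 ∷ [])
  ∷ (a0 ∷ a2 ∷ a1 ∷ a0 ∷ a2 ∷ [])
  ∷ (a1 ∷ a2 ∷ a1 ∷ a0 ∷ a1 ∷ a2 ∷ [])
  ∷ (a0 ∷ a1 ∷ a0 ∷ a2 ∷ a1 ∷ a0 ∷ a1 ∷ a0 ∷ [])
  ∷ (a2 ∷ a1 ∷ a0 ∷ a2 ∷ a1 ∷ a0 ∷ a1 ∷ a2 ∷ a1 ∷ a0 ∷ a2 ∷ [])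
  ∷ []

open import Data.List.Membership.Propositional using (_∈_)

InL : Word → Set
InL w = CubeFree w × (∀ f → f ∈ F → ¬ FactorOf f w)

-- The word p is the limit of the words h^k(0). They avoid F and have no factor x x x⁻ (x⁻ being
-- x without its last letter), since both properties pass from w to h w: the images 01, 21, 0
-- of the letters can be cut apart at every letter other than 1, so an occurrence in h w decodes
-- to an occurrence in w. Excluding x x x⁻ excludes cubes, hence the factors of p lie in L.
--
-- Conversely, let all factors of x lie in L. As 00, 11, 20, 22 are forbidden, x is, after a
-- possible leading 1, the image h y of a word y, and the factors of y again lie in L: a finite
-- certificate shows that six letters of context on each side of a forbidden factor of y produce
-- a forbidden factor or a cube in its image. Each factor of x of length at least 5 lies in the
-- image of a strictly shorter factor of y, recurring when it does. By induction on the length, a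
-- recurrent factor of x is thus a factor of h^k(s) for a word s of L of length at most 5, and an
-- exhaustive check shows that such s are factors of h^6(0).

module Submission where

open import Defs
open import Data.Empty using (⊥; ⊥-elim)
open import Data.Fin using (_≟_)
open import Data.Fin.Properties using (all?)
open import Data.List using ([]; _∷_; _++_; _∷ʳ_; length; map; concat; take; drop; initLast; _∷ʳ′_)
open import Data.List.Membership.Propositional using (_∈_; lose; find)
open import Data.List.Properties
  using (++-assoc; ++-identityʳ; ++-conicalʳ; ++-conicalˡ; ++-monoid; ≡-dec; ∷-injective; ∷-injectiveˡ; ∷-injectiveʳ;
         ∷ʳ-injective; concat-++; map-++; length-++; length-++-≤ˡ; length-++-≤ʳ; length-take; length-drop;
         take++drop≡id)
open import Data.List.Membership.DecPropositional (≡-dec (_≟_ {3})) using (_∈?_)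
open import Data.List.Relation.Binary.Infix.Heterogeneous using (Infix; MkView; toView; fromView)
open import Data.List.Relation.Binary.Infix.Heterogeneous.Properties using (infix?)
open import Data.List.Relation.Binary.Pointwise using (Pointwise-≡⇒≡; ≡⇒Pointwise-≡)
open import Data.List.Relation.Unary.All using (All; []; _∷_; lookup; lookupWith)
open import Data.List.Relation.Unary.Any as Any using (Any; any?)
open import Data.Nat using (ℕ; zero; suc; _+_; _∸_; _≤_; _<_; z≤n; s≤s; pred; _≤?_)
open import Data.Nat.Properties
  using (≤-refl; ≤-trans; ≤-pred; <⇒≤; <⇒≱; ≰⇒>; n≤1+n; m≤m+n; m≤n+m; m<m+n; suc-injective; +-suc;
         +-comm; +-assoc; +-identityʳ; +-monoˡ-≤; +-monoʳ-≤; +-monoʳ-<; +-cancelˡ-≤; m∸n+n≡m;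
         m+[n∸m]≡n; m∸[m∸n]≡n; m≤n⇒m⊓n≡m; module ≤-Reasoning)
open import Data.Nat.Tactic.RingSolver using (solve-∀)
open import Data.Product using (∃-syntax; _×_; _,_; proj₁; proj₂)
open import Data.Sum using (_⊎_; inj₁; inj₂; [_,_]′)
open import Function using (case_of_)
open import Relation.Binary.PropositionalEquality
open import Relation.Nullary using (Dec; yes; no; ¬_)
open import Relation.Nullary.Decidable using (True; toWitness; from-no; map′; _×-dec_; _⊎-dec_)
open import Tactic.MonoidSolver using (solve)

h-++ : ∀ u v → h (u ++ v) ≡ h u ++ h v
h-++ u v = trans (cong concat (map-++ hL u v)) (sym (concat-++ (map hL u) (map hL v)))

h-∷ʳ : ∀ γ e → h (γ ∷ʳ e) ≡ h γ ++ hL e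
h-∷ʳ γ e = trans (h-++ γ (e ∷ [])) (cong (h γ ++_) (++-identityʳ (hL e)))

h-∷ʳ-x1 : ∀ γ e x s → hL e ≡ x ∷ a1 ∷ [] → h (γ ∷ʳ e) ++ s ≡ (h γ ∷ʳ x) ++ a1 ∷ s
h-∷ʳ-x1 γ e x s eqe = begin
  h (γ ∷ʳ e) ++ s                ≡⟨ cong (_++ s) (trans (h-∷ʳ γ e) (cong (h γ ++_) eqe)) ⟩
  (h γ ++ x ∷ a1 ∷ []) ++ s      ≡⟨ ++-assoc (h γ) _ s ⟩
  h γ ++ x ∷ a1 ∷ s              ≡⟨ sym (++-assoc (h γ) _ _) ⟩
  (h γ ∷ʳ x) ++ a1 ∷ s           ∎
  where open ≡-Reasoning

length-∷ʳ : ∀ (u : Word) a → length (u ∷ʳ a) ≡ suc (length u)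
length-∷ʳ u a = trans (length-++ u) (+-comm (length u) 1)

h-≢[] : ∀ {u} → u ≢ [] → h u ≢ []
h-≢[] {[]}     u≢[] _ = u≢[] refl
h-≢[] {a0 ∷ _} _ ()
h-≢[] {a1 ∷ _} _ ()
h-≢[] {a2 ∷ _} _ ()

hL-injective : ∀ c d → hL c ≡ hL d → c ≡ d
hL-injective a0 a0 _ = refl
hL-injective a1 a1 _ = refl
hL-injective a2 a2 _ = refl
hL-injective a0 a1 ()
hL-injective a0 a2 ()
hL-injective a1 a0 ()
hL-injective a1 a2 ()
hL-injective a2 a0 ()
hL-injective a2 a1 ()

FactorOf-refl : ∀ u → FactorOf u u
FactorOf-refl u = [] , [] , sym (++-identityʳ u)

FactorOf-trans : ∀ {u v w} → FactorOf u v → FactorOf v w → FactorOf u w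
FactorOf-trans {u} (x₁ , y₁ , refl) (x₂ , y₂ , refl) = x₂ ++ x₁ , y₁ ++ y₂ , reassoc x₂ x₁ u y₁ y₂
  where
  reassoc : ∀ (a b c d e : Word) → a ++ (b ++ c ++ d) ++ e ≡ (a ++ b) ++ c ++ (d ++ e)
  reassoc a b c d e = solve (++-monoid Letter)

FactorOf-h : ∀ {u v} → FactorOf u v → FactorOf (h u) (h v)
FactorOf-h {u} (x , y , refl) = h x , h y , trans (h-++ x (u ++ y)) (cong (h x ++_) (h-++ u y))

factor-at : ∀ x y f z → FactorOf f (x ++ y ++ f ++ z)
factor-at x y f z = x ++ y , z , sym (++-assoc x y (f ++ z))

factorOf? : ∀ u w → Dec (FactorOf u w)
factorOf? u w = map′ fromInfix toInfix (infix? _≟_ u w)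
  where
  fromInfix : Infix _≡_ u w → FactorOf u w
  fromInfix i with MkView x eq y ← toView i rewrite Pointwise-≡⇒≡ eq = x , y , refl
  toInfix : FactorOf u w → Infix _≡_ u w
  toInfix (x , y , refl) = fromView (MkView x (≡⇒Pointwise-≡ refl) y)

NoLeading1 : Word → Set
NoLeading1 r = ∀ s → r ≢ a1 ∷ s

NoLeading1-∷ : ∀ {x} s → x ≢ a1 → NoLeading1 (x ∷ s)
NoLeading1-∷ s x≢1 s′ eq = x≢1 (∷-injectiveˡ eq)

NoLeading1-h : ∀ w → NoLeading1 (h w)
NoLeading1-h (a0 ∷ w) s ()
NoLeading1-h (a1 ∷ w) s ()
NoLeading1-h (a2 ∷ w) s ()

11∉h : ∀ w a b → h w ≢ a ++ a1 ∷ a1 ∷ b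
11∉h w [] b eq = NoLeading1-h w _ eq
11∉h (a0 ∷ w) (_ ∷ []) b eq = NoLeading1-h w b (∷-injectiveʳ (∷-injectiveʳ eq))
11∉h (a1 ∷ w) (_ ∷ []) b eq = NoLeading1-h w b (∷-injectiveʳ (∷-injectiveʳ eq))
11∉h (a0 ∷ w) (_ ∷ _ ∷ a) b eq = 11∉h w a b (∷-injectiveʳ (∷-injectiveʳ eq))
11∉h (a1 ∷ w) (_ ∷ _ ∷ a) b eq = 11∉h w a b (∷-injectiveʳ (∷-injectiveʳ eq))
11∉h (a2 ∷ w) (_ ∷ a) b eq = 11∉h w a b (∷-injectiveʳ eq)

block-prefix : ∀ c t a r → hL c ++ t ≡ a ++ r → a ≢ [] → NoLeading1 r →
               ∃[ a′ ] (a ≡ hL c ++ a′ × t ≡ a′ ++ r)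
block-prefix c t [] r _ a≢[] _ = ⊥-elim (a≢[] refl)
block-prefix a0 t (_ ∷ []) r eq _ nl = ⊥-elim (nl t (sym (∷-injectiveʳ eq)))
block-prefix a1 t (_ ∷ []) r eq _ nl = ⊥-elim (nl t (sym (∷-injectiveʳ eq)))
block-prefix a0 t (x ∷ y ∷ a) r eq _ _
  with refl , _ ← ∷-injective eq | refl , eq₂ ← ∷-injective (∷-injectiveʳ eq) = a , refl , eq₂
block-prefix a1 t (x ∷ y ∷ a) r eq _ _
  with refl , _ ← ∷-injective eq | refl , eq₂ ← ∷-injective (∷-injectiveʳ eq) = a , refl , eq₂
block-prefix a2 t (x ∷ a) r eq _ _ with refl , eq₁ ← ∷-injective eq = a , refl , eq₁

h-split : ∀ w a r → h w ≡ a ++ r → NoLeading1 r →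
          ∃[ w₁ ] ∃[ w₂ ] (w ≡ w₁ ++ w₂ × h w₁ ≡ a × h w₂ ≡ r)
h-split w [] r eq _ = [] , w , refl , refl , eq
h-split [] (x ∷ a) r () _
h-split (c ∷ w) (x ∷ a) r eq nl with block-prefix c (h w) (x ∷ a) r eq (λ ()) nl
... | a′ , eqa , eqt with h-split w a′ r eqt nl
... | w₁ , w₂ , refl , e₁ , e₂ = c ∷ w₁ , w₂ , refl , trans (cong (hL c ++_) e₁) (sym eqa) , e₂

h-injective : ∀ u v → h u ≡ h v → u ≡ v
h-injective [] [] _ = refl
h-injective [] (c ∷ v) eq = ⊥-elim (h-≢[] {c ∷ v} (λ ()) (sym eq))
h-injective (c ∷ u) [] eq = ⊥-elim (h-≢[] {c ∷ u} (λ ()) eq)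
h-injective (a0 ∷ u) (a0 ∷ v) eq = cong (a0 ∷_) (h-injective u v (∷-injectiveʳ (∷-injectiveʳ eq)))
h-injective (a1 ∷ u) (a1 ∷ v) eq = cong (a1 ∷_) (h-injective u v (∷-injectiveʳ (∷-injectiveʳ eq)))
h-injective (a2 ∷ u) (a2 ∷ v) eq = cong (a2 ∷_) (h-injective u v (∷-injectiveʳ eq))
h-injective (a0 ∷ u) (a2 ∷ v) eq = ⊥-elim (NoLeading1-h v (h u) (sym (∷-injectiveʳ eq)))
h-injective (a2 ∷ u) (a0 ∷ v) eq = ⊥-elim (NoLeading1-h u (h v) (∷-injectiveʳ eq))
h-injective (a0 ∷ u) (a1 ∷ v) ()
h-injective (a1 ∷ u) (a0 ∷ v) ()
h-injective (a1 ∷ u) (a2 ∷ v) ()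
h-injective (a2 ∷ u) (a1 ∷ v) ()

h-head-x1 : ∀ w d s → h w ≡ d ∷ a1 ∷ s →
            ∃[ e ] ∃[ w′ ] (w ≡ e ∷ w′ × hL e ≡ d ∷ a1 ∷ [] × h w′ ≡ s)
h-head-x1 (a0 ∷ w) d s refl = a0 , w , refl , refl , refl
h-head-x1 (a1 ∷ w) d s refl = a1 , w , refl , refl , refl
h-head-x1 (a2 ∷ w) d s eq   = ⊥-elim (NoLeading1-h w s (∷-injectiveʳ eq))

h-head-01 : ∀ w s → h w ≡ a0 ∷ a1 ∷ s → ∃[ w′ ] (w ≡ a0 ∷ w′ × h w′ ≡ s)
h-head-01 (a0 ∷ w) s refl = w , refl , refl
h-head-01 (a2 ∷ w) s eq   = ⊥-elim (NoLeading1-h w s (∷-injectiveʳ eq))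

h-head-0x : ∀ w x s → x ≢ a1 → h w ≡ a0 ∷ x ∷ s → ∃[ w′ ] (w ≡ a2 ∷ w′ × h w′ ≡ x ∷ s)
h-head-0x (a0 ∷ w) x s x≢1 refl = ⊥-elim (x≢1 refl)
h-head-0x (a2 ∷ w) x s _    eq   = w , refl , ∷-injectiveʳ eq

h-head-2 : ∀ w s → h w ≡ a2 ∷ s → ∃[ w′ ] (w ≡ a1 ∷ w′ × s ≡ a1 ∷ h w′)
h-head-2 (a1 ∷ w) s refl = w , refl , refl
h-head-2 (a0 ∷ w) s ()
h-head-2 (a2 ∷ w) s ()

h-head-0 : ∀ w s → h w ≡ a0 ∷ s → ∃[ w′ ] (w ≡ a0 ∷ w′ ⊎ w ≡ a2 ∷ w′)
h-head-0 (a0 ∷ w) s _ = w , inj₁ refl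
h-head-0 (a2 ∷ w) s _ = w , inj₂ refl

2x∉h : ∀ w x a b → x ≢ a1 → h w ≢ a ++ a2 ∷ x ∷ b
2x∉h w x a b x≢1 eq
  with w₁ , w₂ , refl , _ , e₂ ← h-split w a _ eq (NoLeading1-∷ _ λ ())
  with _ , refl , e ← h-head-2 w₂ _ e₂ = x≢1 (∷-injectiveˡ e)

-- Forbidden factors

Forbidden : Word → Set
Forbidden w = Any (λ f → FactorOf f w) F

forbidden? : ∀ w → Dec (Forbidden w)
forbidden? w = any? (λ f → factorOf? f w) F

forbidden : ∀ f {f∈F : True (f ∈? F)} {w} → FactorOf f w → Forbidden w
forbidden f {f∈F} = lose (toWitness f∈F)

InL⇒¬Forbidden : ∀ {w} → InL w → ¬ Forbidden w
InL⇒¬Forbidden (_ , avoids) any with f , f∈F , fac ← find any = avoids f f∈F fac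

InL-factor : ∀ {u w} → FactorOf u w → InL w → InL u
InL-factor u⊑w (cf , avoids) =
  (λ s s≢[] sss⊑u → cf s s≢[] (FactorOf-trans sss⊑u u⊑w)) ,
  (λ f f∈F f⊑u → avoids f f∈F (FactorOf-trans f⊑u u⊑w))

Forbidden-factor : ∀ {u w} → FactorOf u w → Forbidden u → Forbidden w
Forbidden-factor u⊑w = Any.map (λ f⊑u → FactorOf-trans f⊑u u⊑w)

image-00 : ∀ w → FactorOf (a0 ∷ a0 ∷ []) (h w) → Forbidden w
image-00 w (X , Y , eq)
  with w₁ , w₂ , refl , _ , e₂ ← h-split w X _ eq (NoLeading1-∷ _ λ ())
  with w₃ , refl , e₃ ← h-head-0x w₂ a0 Y (λ ()) e₂
  with h-head-0 w₃ Y e₃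
... | w₄ , inj₁ refl = forbidden (a2 ∷ a0 ∷ []) (w₁ , w₄ , refl)
... | w₄ , inj₂ refl = forbidden (a2 ∷ a2 ∷ []) (w₁ , w₄ , refl)

image-11 : ∀ w → FactorOf (a1 ∷ a1 ∷ []) (h w) → Forbidden w
image-11 w (X , Y , eq) = ⊥-elim (11∉h w X Y eq)

image-22 : ∀ w → FactorOf (a2 ∷ a2 ∷ []) (h w) → Forbidden w
image-22 w (X , Y , eq) = ⊥-elim (2x∉h w a2 X Y (λ ()) eq)

image-20 : ∀ w → FactorOf (a2 ∷ a0 ∷ []) (h w) → Forbidden w
image-20 w (X , Y , eq) = ⊥-elim (2x∉h w a0 X Y (λ ()) eq)

image-212 : ∀ w → FactorOf (a2 ∷ a1 ∷ a2 ∷ []) (h w) → Forbidden w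
image-212 w (X , Y , eq)
  with w₁ , w₂ , refl , _ , e₂ ← h-split w X _ eq (NoLeading1-∷ _ λ ())
  with w₃ , refl , e₃ ← h-head-2 w₂ _ e₂
  with w₄ , refl , _ ← h-head-2 w₃ Y (sym (∷-injectiveʳ e₃))
  = forbidden (a1 ∷ a1 ∷ []) (w₁ , w₄ , refl)

image-0101 : ∀ w → FactorOf (a0 ∷ a1 ∷ a0 ∷ a1 ∷ []) (h w) → Forbidden w
image-0101 w (X , Y , eq)
  with w₁ , w₂ , refl , _ , e₂ ← h-split w X _ eq (NoLeading1-∷ _ λ ())
  with w₃ , refl , e₃ ← h-head-01 w₂ _ e₂
  with w₄ , refl , _ ← h-head-01 w₃ _ e₃
  = forbidden (a0 ∷ a0 ∷ []) (w₁ , w₄ , refl)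

image-02102 : ∀ w → FactorOf (a0 ∷ a2 ∷ a1 ∷ a0 ∷ a2 ∷ []) (h w) → Forbidden w
image-02102 w (X , Y , eq)
  with w₁ , w₂ , refl , _ , e₂ ← h-split w X _ eq (NoLeading1-∷ _ λ ())
  with w₃ , refl , e₃ ← h-head-0x w₂ a2 _ (λ ()) e₂
  with w₄ , refl , e₄ ← h-head-2 w₃ _ e₃
  with w₅ , refl , e₅ ← h-head-0x w₄ a2 _ (λ ()) (sym (∷-injectiveʳ e₄))
  with w₆ , refl , _ ← h-head-2 w₅ _ e₅
  = forbidden (a2 ∷ a1 ∷ a2 ∷ []) (w₁ , a1 ∷ w₆ , refl)

image-121012 : ∀ w → FactorOf (a1 ∷ a2 ∷ a1 ∷ a0 ∷ a1 ∷ a2 ∷ []) (h w) → Forbidden w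
image-121012 w (X , Y , eq)
  with w₁ , w₂ , refl , e₁ , e₂ ← h-split w (X ∷ʳ a1) _ (trans eq (sym (++-assoc X _ _))) (NoLeading1-∷ _ λ ())
  with w₃ , refl , e₃ ← h-head-2 w₂ _ e₂
  with w₄ , refl , e₄ ← h-head-01 w₃ _ (sym (∷-injectiveʳ e₃))
  with w₅ , refl , _ ← h-head-2 w₄ _ e₄
  with initLast w₁
... | [] with () ← ++-conicalʳ X (a1 ∷ []) (sym e₁)
... | w₀ ∷ʳ′ a0 = forbidden (a0 ∷ a1 ∷ a0 ∷ a1 ∷ []) (w₀ , w₅ , ++-assoc w₀ _ _)
... | w₀ ∷ʳ′ a1 = forbidden (a1 ∷ a1 ∷ []) (w₀ , a0 ∷ a1 ∷ w₅ , ++-assoc w₀ _ _)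
... | w₀ ∷ʳ′ a2 with () ← ∷ʳ-injective (h w₀) X (trans (sym (h-++ w₀ (a2 ∷ []))) e₁)

image-01021010 : ∀ w → FactorOf (a0 ∷ a1 ∷ a0 ∷ a2 ∷ a1 ∷ a0 ∷ a1 ∷ a0 ∷ []) (h w) → Forbidden w
image-01021010 w (X , Y , eq)
  with w₁ , w₂ , refl , _ , e₂ ← h-split w X _ eq (NoLeading1-∷ _ λ ())
  with w₃ , refl , e₃ ← h-head-01 w₂ _ e₂
  with w₄ , refl , e₄ ← h-head-0x w₃ a2 _ (λ ()) e₃
  with w₅ , refl , e₅ ← h-head-2 w₄ _ e₄
  with w₆ , refl , e₆ ← h-head-01 w₅ _ (sym (∷-injectiveʳ e₅))
  with h-head-0 w₆ Y e₆
... | w₇ , inj₁ refl = forbidden (a0 ∷ a0 ∷ []) (factor-at w₁ (a0 ∷ a2 ∷ a1 ∷ []) _ w₇)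
... | w₇ , inj₂ refl = forbidden (a0 ∷ a2 ∷ a1 ∷ a0 ∷ a2 ∷ []) (w₁ , w₇ , refl)

image-21021012102 : ∀ w →
  FactorOf (a2 ∷ a1 ∷ a0 ∷ a2 ∷ a1 ∷ a0 ∷ a1 ∷ a2 ∷ a1 ∷ a0 ∷ a2 ∷ []) (h w) → Forbidden w
image-21021012102 w (X , Y , eq)
  with w₁ , w₂ , refl , _ , e₂ ← h-split w X _ eq (NoLeading1-∷ _ λ ())
  with w₃ , refl , e₃ ← h-head-2 w₂ _ e₂
  with w₄ , refl , e₄ ← h-head-0x w₃ a2 _ (λ ()) (sym (∷-injectiveʳ e₃))
  with w₅ , refl , e₅ ← h-head-2 w₄ _ e₄
  with w₆ , refl , e₆ ← h-head-01 w₅ _ (sym (∷-injectiveʳ e₅))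
  with w₇ , refl , e₇ ← h-head-2 w₆ _ e₆
  with w₈ , refl , e₈ ← h-head-0x w₇ a2 _ (λ ()) (sym (∷-injectiveʳ e₇))
  with w₉ , refl , _ ← h-head-2 w₈ _ e₈
  = forbidden (a1 ∷ a2 ∷ a1 ∷ a0 ∷ a1 ∷ a2 ∷ []) (w₁ , a1 ∷ w₉ , refl)

Forbidden-h⁻¹ : ∀ w → Forbidden (h w) → Forbidden w
Forbidden-h⁻¹ w = lookupWith {P = λ f → FactorOf f (h w) → Forbidden w} {Q = λ f → FactorOf f (h w)}
  {R = λ _ → Forbidden w} (λ image fac → image fac)
  ( image-00 w ∷ image-11 w ∷ image-22 w ∷ image-20 w ∷ image-212 w ∷ image-0101 w
  ∷ image-02102 w ∷ image-121012 w ∷ image-01021010 w ∷ image-21021012102 w ∷ [])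

-- Almost cubes

-- Factors x x x⁻ with x = u c and x⁻ = u. Excluding them is stronger than cube-freeness and,
-- together with avoiding F, it is preserved by h.
AlmostCubeFree : Word → Set
AlmostCubeFree w = ∀ a u c b → w ≢ a ++ (u ∷ʳ c) ++ (u ∷ʳ c) ++ u ++ b

AlmostCubeFree⇒CubeFree : ∀ {w} → AlmostCubeFree w → CubeFree w
AlmostCubeFree⇒CubeFree acf u u≢[] (a , b , eq) with initLast u
... | []       = u≢[] refl
... | v ∷ʳ′ c = acf a v c (c ∷ b) (trans eq (regroup a v (c ∷ []) b))
  where
  regroup : ∀ (A V C B : Word) → A ++ ((V ++ C) ++ (V ++ C) ++ (V ++ C)) ++ B
                               ≡ A ++ (V ++ C) ++ (V ++ C) ++ V ++ C ++ B
  regroup A V C B = solve (++-monoid Letter)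

AlmostCubeFree-factor : ∀ {u w} → FactorOf u w → AlmostCubeFree w → AlmostCubeFree u
AlmostCubeFree-factor (x , y , refl) acf a v c b eq =
  acf (x ++ a) v c (b ++ y) (trans (cong (λ z → x ++ z ++ y) eq) (regroup x a (v ∷ʳ c) v b y))
  where
  regroup : ∀ (X A U V B Y : Word) → X ++ (A ++ U ++ U ++ V ++ B) ++ Y ≡ (X ++ A) ++ U ++ U ++ V ++ (B ++ Y)
  regroup X A U V B Y = solve (++-monoid Letter)

-- Unless a block ends in 2, its image ends in 1 and so cannot be followed by another 1.
after-block : ∀ w g b → h w ≡ h g ++ b → NoLeading1 b ⊎ ∃[ γ ] (g ≡ γ ∷ʳ a2)
after-block w g b eq with initLast g
... | []        = inj₁ (subst NoLeading1 eq (NoLeading1-h w))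
... | γ ∷ʳ′ a0 = inj₁ λ { s refl → 11∉h w (h γ ∷ʳ a0) s (trans eq (h-∷ʳ-x1 γ a0 a0 _ refl)) }
... | γ ∷ʳ′ a1 = inj₁ λ { s refl → 11∉h w (h γ ∷ʳ a2) s (trans eq (h-∷ʳ-x1 γ a1 a2 _ refl)) }
... | γ ∷ʳ′ a2 = inj₂ (γ , refl)

h-prefix : ∀ w v r → h w ≡ h v ++ r → NoLeading1 r → ∃[ w′ ] (w ≡ v ++ w′)
h-prefix w v r eq nl with w₁ , w′ , refl , e₁ , _ ← h-split w (h v) r eq nl
                     with refl ← h-injective w₁ v e₁ = w′ , refl

almostCube-lift : ∀ {w} w₁ v e w₄ r → w ≡ w₁ ++ (v ∷ʳ e) ++ (v ∷ʳ e) ++ w₄ → AlmostCubeFree w →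
                  h w₄ ≡ h v ++ r → NoLeading1 r → ⊥
almostCube-lift w₁ v e w₄ r refl acf eq nl with w′ , refl ← h-prefix w₄ v r eq nl = acf w₁ v e w′ refl

-- If v e is a preimage of the period U c and h w₄ starts with U, then w₄ continues with the
-- blocks of v, unless v e ends in 22.
period-end : ∀ v e U c w₄ b → h (v ∷ʳ e) ≡ U ∷ʳ c → h w₄ ≡ U ++ b →
             (∃[ r ] (h w₄ ≡ h v ++ r × NoLeading1 r)) ⊎ ∃[ γ ] (v ≡ γ ∷ʳ a2 × e ≡ a2)
period-end v a0 U c w₄ b ev e₄
  with refl , _ ← ∷ʳ-injective (h v ∷ʳ a0) U (trans (sym (h-∷ʳ-x1 v a0 a0 [] refl)) (trans (++-identityʳ _) ev))
  = inj₁ (a0 ∷ b , trans e₄ (++-assoc (h v) _ b) , NoLeading1-∷ b λ ())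
period-end v a1 U c w₄ b ev e₄
  with refl , _ ← ∷ʳ-injective (h v ∷ʳ a2) U (trans (sym (h-∷ʳ-x1 v a1 a2 [] refl)) (trans (++-identityʳ _) ev))
  = inj₁ (a2 ∷ b , trans e₄ (++-assoc (h v) _ b) , NoLeading1-∷ b λ ())
period-end v a2 U c w₄ b ev e₄
  with refl , _ ← ∷ʳ-injective (h v) U (trans (sym (h-∷ʳ v a2)) ev)
  with after-block w₄ v b e₄
... | inj₁ nl          = inj₁ (b , e₄ , nl)
... | inj₂ (γ , refl) = inj₂ (γ , refl , refl)

-- A period starting with 0 or 2 is made of whole blocks, so the occurrence lifts to w.
almostCube-aligned : ∀ w a x u c b → x ≢ a1 → AlmostCubeFree w → ¬ Forbidden w →
                     h w ≢ a ++ ((x ∷ u) ∷ʳ c) ++ ((x ∷ u) ∷ʳ c) ++ (x ∷ u) ++ b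
almostCube-aligned w a x u c b x≢1 acf ¬fw eq
  with w₁ , w₂ , refl , _ , e₂ ← h-split w a _ eq (NoLeading1-∷ _ x≢1)
  with v , w₃ , refl , ev , e₃ ← h-split w₂ ((x ∷ u) ∷ʳ c) _ e₂ (NoLeading1-∷ _ x≢1)
  with v′ , w₄ , refl , ev′ , e₄ ← h-split w₃ ((x ∷ u) ∷ʳ c) _ e₃ (NoLeading1-∷ _ x≢1)
  with refl ← h-injective v′ v (trans ev′ (sym ev))
  with initLast v
... | [] with () ← ev
... | v⁻ ∷ʳ′ e with period-end v⁻ e (x ∷ u) c w₄ b ev e₄
...   | inj₁ (r , eqr , nl)   = almostCube-lift w₁ v⁻ e w₄ r refl acf eqr nl
...   | inj₂ (γ , refl , refl) = ¬fw (forbidden (a2 ∷ a2 ∷ []) (w₁ ++ γ , _ , reassoc w₁ γ (a2 ∷ []) _))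
  where
  reassoc : ∀ (A G T R : Word) → A ++ ((G ++ T) ++ T) ++ R ≡ (A ++ G) ++ (T ++ T) ++ R
  reassoc A G T R = solve (++-monoid Letter)

reassoc-block : ∀ (A P G T R : Word) → A ++ (P ++ ((G ++ T) ++ R)) ≡ (A ++ (P ++ G)) ++ T ++ R
reassoc-block A P G T R = solve (++-monoid Letter)

forbidden-after-2 : ∀ w₁ d c D γ E w₇ → d ≢ c → hL D ≡ d ∷ a1 ∷ [] → hL E ≡ c ∷ a1 ∷ [] →
                    Forbidden (w₁ ++ D ∷ ((γ ∷ʳ a2) ++ E ∷ ((γ ∷ʳ a2) ++ E ∷ w₇)))
forbidden-after-2 w₁ d c D γ a0 w₇ _ _ _ =
  forbidden (a2 ∷ a0 ∷ []) (w₁ ++ D ∷ γ , _ , reassoc-block w₁ (D ∷ []) γ (a2 ∷ []) _)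
forbidden-after-2 _ _ _ _ _ a2 _ _ _ ()
forbidden-after-2 _ _ _ a2 _ a1 _ _ () _
forbidden-after-2 w₁ d .a2 a1 γ a1 w₇ d≢c refl refl = ⊥-elim (d≢c refl)
forbidden-after-2 w₁ .a0 .a2 a0 [] a1 w₇ _ refl refl =
  forbidden (a2 ∷ a1 ∷ a2 ∷ []) (factor-at w₁ (a0 ∷ []) _ (a1 ∷ w₇))
forbidden-after-2 w₁ .a0 .a2 a0 (a0 ∷ γ) a1 w₇ _ refl refl = forbidden (a0 ∷ a0 ∷ []) (w₁ , _ , refl)
forbidden-after-2 w₁ .a0 .a2 a0 (a1 ∷ γ) a1 w₇ _ refl refl =
  forbidden (a1 ∷ a1 ∷ []) (factor-at w₁ (a0 ∷ a1 ∷ γ ∷ʳ a2) _ ((γ ∷ʳ a2) ++ a1 ∷ w₇))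
forbidden-after-2 w₁ .a0 .a2 a0 (a2 ∷ γ) a1 w₇ _ refl refl =
  forbidden (a2 ∷ a1 ∷ a2 ∷ []) (w₁ ++ a0 ∷ a2 ∷ γ , _ , reassoc-block w₁ (a0 ∷ a2 ∷ []) γ (a2 ∷ []) _)

private
  unfold-period : ∀ (A D X U C B : Word) → (A ++ D) ++ ((X ++ U) ++ C) ++ ((X ++ U) ++ C) ++ (X ++ U) ++ B
                                   ≡ A ++ D ++ X ++ U ++ C ++ X ++ U ++ C ++ X ++ U ++ B
  unfold-period A D X U C B = solve (++-monoid Letter)

  fold-period : ∀ (A D G E W : Word) → A ++ D ++ G ++ E ++ G ++ E ++ W ≡ (A ++ D) ++ (G ++ E) ++ (G ++ E) ++ W
  fold-period A D G E W = solve (++-monoid Letter)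

almostCube-mismatch : ∀ w a d c u b → d ≢ a1 → c ≢ a1 → d ≢ c → AlmostCubeFree w → ¬ Forbidden w →
                      h w ≢ (a ∷ʳ d) ++ ((a1 ∷ u) ∷ʳ c) ++ ((a1 ∷ u) ∷ʳ c) ++ (a1 ∷ u) ++ b
almostCube-mismatch w a d c u b d≢1 c≢1 d≢c acf ¬fw eq
  with w₁ , w₂ , refl , _ , e₂ ← h-split w a _ (trans eq (unfold-period a (d ∷ []) (a1 ∷ []) u (c ∷ []) b))
                                         (NoLeading1-∷ _ d≢1)
  with D , w₃ , refl , eD , e₃ ← h-head-x1 w₂ d _ e₂
  with g , w₄ , refl , eg , e₄ ← h-split w₃ u _ e₃ (NoLeading1-∷ _ c≢1)
  with E , w₅ , refl , eE , e₅ ← h-head-x1 w₄ c _ e₄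
  with g′ , w₆ , refl , eg′ , e₆ ← h-split w₅ u _ e₅ (NoLeading1-∷ _ c≢1)
  with refl ← h-injective g′ g (trans eg′ (sym eg))
  with E′ , w₇ , refl , eE′ , e₇ ← h-head-x1 w₆ c _ e₆
  with refl ← hL-injective E′ E (trans eE′ (sym eE))
  with e₇′ ← trans e₇ (cong (_++ b) (sym eg))
  with after-block w₇ g b e₇′
... | inj₁ nl = almostCube-lift (w₁ ∷ʳ D) g E w₇ b (fold-period w₁ (D ∷ []) g (E ∷ []) w₇) acf e₇′ nl
... | inj₂ (γ , refl) = ¬fw (forbidden-after-2 w₁ d c D γ E w₇ d≢c eD eE)

almostCube-shift : ∀ w a c U b → c ≢ a1 → U ≢ [] → AlmostCubeFree w → ¬ Forbidden w →
                   h w ≢ (a ∷ʳ c) ++ (U ∷ʳ c) ++ (U ∷ʳ c) ++ U ++ b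
almostCube-shift w a c U b c≢1 U≢[] acf ¬fw eq with initLast U
... | [] = U≢[] refl
... | U⁻ ∷ʳ′ g =
  almostCube-aligned w a c U⁻ g (g ∷ b) c≢1 acf ¬fw (trans eq (rotate a (c ∷ []) U⁻ (g ∷ []) b))
  where
  rotate : ∀ (A C V G B : Word) → (A ++ C) ++ ((V ++ G) ++ C) ++ ((V ++ G) ++ C) ++ (V ++ G) ++ B
                                  ≡ A ++ ((C ++ V) ++ G) ++ ((C ++ V) ++ G) ++ (C ++ V) ++ G ++ B
  rotate A C V G B = solve (++-monoid Letter)

-- The case of a period starting with 1: the letter d before the almost cube decides between
-- a shifted aligned occurrence (d = c) and a mismatch (d ≠ c).
almostCube-1 : ∀ w a d u c b → AlmostCubeFree w → ¬ Forbidden w →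
               h w ≢ (a ∷ʳ d) ++ ((a1 ∷ u) ∷ʳ c) ++ ((a1 ∷ u) ∷ʳ c) ++ (a1 ∷ u) ++ b
almostCube-1 w a a1 u c b _ _ eq = 11∉h w a _ (trans eq (++-assoc a _ _))
almostCube-1 w a d u a1 b _ _ eq =
  11∉h w ((a ∷ʳ d) ++ a1 ∷ u) _
       (trans eq (trans (cong (λ z → (a ∷ʳ d) ++ a1 ∷ z) (++-assoc u _ _))
                        (sym (++-assoc (a ∷ʳ d) (a1 ∷ u) _))))
almostCube-1 w a a0 u a0 b = almostCube-shift w a a0 (a1 ∷ u) b (λ ()) (λ ())
almostCube-1 w a a2 u a2 b = almostCube-shift w a a2 (a1 ∷ u) b (λ ()) (λ ())
almostCube-1 w a a0 u a2 b = almostCube-mismatch w a a0 a2 u b (λ ()) (λ ()) (λ ())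
almostCube-1 w a a2 u a0 b = almostCube-mismatch w a a2 a0 u b (λ ()) (λ ()) (λ ())

AlmostCubeFree-h : ∀ w → AlmostCubeFree w → ¬ Forbidden w → AlmostCubeFree (h w)
AlmostCubeFree-h w acf ¬fw a [] a0 b eq = ¬fw (image-00 w (a , b , eq))
AlmostCubeFree-h w acf ¬fw a [] a1 b eq = 11∉h w a b eq
AlmostCubeFree-h w acf ¬fw a [] a2 b eq = 2x∉h w a2 a b (λ ()) eq
AlmostCubeFree-h w acf ¬fw a (a0 ∷ u) c b = almostCube-aligned w a a0 u c b (λ ()) acf ¬fw
AlmostCubeFree-h w acf ¬fw a (a2 ∷ u) c b = almostCube-aligned w a a2 u c b (λ ()) acf ¬fw
AlmostCubeFree-h w acf ¬fw a (a1 ∷ u) c b eq with initLast a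
... | []       = NoLeading1-h w _ eq
... | a′ ∷ʳ′ d = almostCube-1 w a′ d u c b acf ¬fw eq

-- The factors of p

H : ℕ → Word
H k = hIter k (a0 ∷ [])

H-avoids : ∀ k → AlmostCubeFree (H k) × ¬ Forbidden (H k)
H-avoids zero = acf-0 , from-no (forbidden? (a0 ∷ []))
  where
  nonempty : ∀ u c r → (u ∷ʳ c) ++ r ≢ []
  nonempty u c r eq with () ← ++-conicalʳ u (c ∷ []) (++-conicalˡ _ r eq)
  acf-0 : AlmostCubeFree (a0 ∷ [])
  acf-0 [] [] c b ()
  acf-0 [] (x ∷ u) c b eq = nonempty u c _ (sym (∷-injectiveʳ eq))
  acf-0 (y ∷ a) u c b eq = nonempty u c _ (++-conicalʳ a _ (sym (∷-injectiveʳ eq)))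
H-avoids (suc k) with acf , ¬fw ← H-avoids k =
  AlmostCubeFree-h (H k) acf ¬fw , λ fw → ¬fw (Forbidden-h⁻¹ (H k) fw)

FactorOf-H⇒InL : ∀ {w} k → FactorOf w (H k) → InL w
FactorOf-H⇒InL k w⊑H with acf , ¬fw ← H-avoids k =
  AlmostCubeFree⇒CubeFree (AlmostCubeFree-factor w⊑H acf) ,
  λ f f∈F f⊑w → ¬fw (Forbidden-factor w⊑H (lose f∈F f⊑w))

H-step : ∀ k → ∃[ r ] (r ≢ [] × H (suc k) ≡ H k ++ r)
H-step zero = a1 ∷ [] , (λ ()) , refl
H-step (suc k) with r , r≢[] , eq ← H-step k = h r , h-≢[] r≢[] , trans (cong h eq) (h-++ (H k) r)

H-prefix : ∀ m k → ∃[ r ] (H (m + k) ≡ H k ++ r)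
H-prefix zero    k = [] , sym (++-identityʳ (H k))
H-prefix (suc m) k with r , eq ← H-prefix m k | r′ , _ , eq′ ← H-step (m + k) =
  r ++ r′ , trans eq′ (trans (cong (_++ r′) eq) (++-assoc (H k) r r′))

H-length : ∀ k → k < length (H k)
H-length zero = s≤s z≤n
H-length (suc k) with r , r≢[] , eq ← H-step k = begin-strict
  suc k                   ≤⟨ H-length k ⟩
  length (H k)            <⟨ m<m+n (length (H k)) (nonempty-length r≢[]) ⟩
  length (H k) + length r ≡⟨ sym (trans (cong length eq) (length-++ (H k))) ⟩
  length (H (suc k))      ∎
  where
  open ≤-Reasoning
  nonempty-length : ∀ {r : Word} → r ≢ [] → 0 < length r
  nonempty-length {[]} r≢[] = ⊥-elim (r≢[] refl)
  nonempty-length {_ ∷ _} _ = s≤s z≤n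

at-++ˡ : ∀ u r i → i < length u → at (u ++ r) i ≡ at u i
at-++ˡ (x ∷ u) r zero    _       = refl
at-++ˡ (x ∷ u) r (suc i) (s≤s q) = at-++ˡ u r i q

at-++ʳ : ∀ u r i → at (u ++ r) (length u + i) ≡ at r i
at-++ʳ []      r i = refl
at-++ʳ (x ∷ u) r i = at-++ʳ u r i

p-at-H : ∀ k i → i < length (H k) → p i ≡ at (H k) i
p-at-H k i i<|Hk| with r₁ , e₁ ← H-prefix k (suc i) | r₂ , e₂ ← H-prefix (suc i) k = begin
  at (H (suc i)) i       ≡⟨ sym (at-++ˡ (H (suc i)) r₁ i (≤-trans (n≤1+n (suc i)) (H-length (suc i)))) ⟩
  at (H (suc i) ++ r₁) i ≡⟨ cong (λ z → at z i) (sym e₁) ⟩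
  at (H (k + suc i)) i   ≡⟨ cong (λ n → at (H n) i) (+-comm k (suc i)) ⟩
  at (H (suc i + k)) i   ≡⟨ cong (λ z → at z i) e₂ ⟩
  at (H k ++ r₂) i       ≡⟨ at-++ˡ (H k) r₂ i i<|Hk| ⟩
  at (H k) i             ∎
  where open ≡-Reasoning

slice-agree : ∀ (f : InfWord) i u → (∀ j → j < length u → f (j + i) ≡ at u j) → slice f i (length u) ≡ u
slice-agree f i []      _  = refl
slice-agree f i (x ∷ u) ag =
  cong₂ _∷_ (ag 0 (s≤s z≤n)) (slice-agree f (suc i) u λ j j< → trans (cong f (+-suc j i)) (ag (suc j) (s≤s j<)))

slice-++ : ∀ (f : InfWord) i m n → slice f i (m + n) ≡ slice f i m ++ slice f (m + i) n
slice-++ f i zero    n = refl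
slice-++ f i (suc m) n = cong (f i ∷_)
  (trans (slice-++ f (suc i) m n) (cong (λ k → slice f (suc i) m ++ slice f k n) (+-suc m i)))

length-slice : ∀ (f : InfWord) i m → length (slice f i m) ≡ m
length-slice f i zero    = refl
length-slice f i (suc m) = cong suc (length-slice f (suc i) m)

slice-factor : ∀ (f : InfWord) a L i n → a ≤ i → i + n ≤ a + L → FactorOf (slice f i n) (slice f a L)
slice-factor f a L i n a≤i i+n≤a+L = slice f a d , slice f (n + i) r , (begin
  slice f a L                                        ≡⟨ cong (slice f a) L≡d+n+r ⟩
  slice f a (d + (n + r))                            ≡⟨ slice-++ f a d (n + r) ⟩
  slice f a d ++ slice f (d + a) (n + r)             ≡⟨ cong (λ k → slice f a d ++ slice f k (n + r)) d+a≡i ⟩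
  slice f a d ++ slice f i (n + r)                   ≡⟨ cong (slice f a d ++_) (slice-++ f i n r) ⟩
  slice f a d ++ slice f i n ++ slice f (n + i) r    ∎)
  where
  open ≡-Reasoning
  d = i ∸ a
  r = L ∸ (d + n)
  d+a≡i : d + a ≡ i
  d+a≡i = m∸n+n≡m a≤i
  d+n≤L : d + n ≤ L
  d+n≤L = +-cancelˡ-≤ a (d + n) L (subst (_≤ a + L) i+n≡a+[d+n] i+n≤a+L)
    where
    i+n≡a+[d+n] : i + n ≡ a + (d + n)
    i+n≡a+[d+n] = sym (trans (sym (+-assoc a d n)) (cong (_+ n) (trans (+-comm a d) d+a≡i)))
  L≡d+n+r : L ≡ d + (n + r)
  L≡d+n+r = trans (sym (m+[n∸m]≡n d+n≤L)) (+-assoc d n r)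

p-prefix : ∀ k → slice p 0 (length (H k)) ≡ H k
p-prefix k = slice-agree p 0 (H k) λ j j< → trans (cong p (+-identityʳ j)) (p-at-H k j j<)

FactorOfH : Word → Set
FactorOfH w = ∃[ k ] FactorOf w (H k)

Factor⇒FactorOfH : ∀ {w} → Factor w p → FactorOfH w
Factor⇒FactorOfH {w} (i , occ) = k , subst₂ FactorOf occ (p-prefix k)
  (slice-factor p 0 (length (H k)) i (length w) z≤n (<⇒≤ (H-length k)))
  where k = i + length w

FactorOfH⇒Factor : ∀ {w} → FactorOfH w → Factor w p
FactorOfH⇒Factor {w} (k , X , Y , eq) = length X , slice-agree p (length X) w agree
  where
  |Hk| : length (H k) ≡ length X + (length w + length Y)
  |Hk| = trans (cong length eq) (trans (length-++ X) (cong (length X +_) (length-++ w)))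
  agree : ∀ j → j < length w → p (j + length X) ≡ at w j
  agree j j< = begin
    p (j + length X)              ≡⟨ p-at-H k _ bound ⟩
    at (H k) (j + length X)       ≡⟨ cong₂ at eq (+-comm j (length X)) ⟩
    at (X ++ w ++ Y) (length X + j) ≡⟨ at-++ʳ X (w ++ Y) j ⟩
    at (w ++ Y) j                 ≡⟨ at-++ˡ w Y j j< ⟩
    at w j                        ∎
    where
    open ≡-Reasoning
    bound : j + length X < length (H k)
    bound = subst₂ _<_ (+-comm (length X) j) (sym |Hk|)
              (+-monoʳ-< (length X) (≤-trans j< (m≤m+n (length w) (length Y))))

-- Finite checks

-- BadExtensions l r u: for all words c, d of lengths l and r, the image h (c ++ u ++ d) has a
-- forbidden factor or a cube. The leaves are checked by evaluating the decision procedures.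
data BadExtensions : ℕ → ℕ → Word → Set where
  forbid : ∀ {l r u} {found : True (forbidden? (h u))} → BadExtensions l r u
  cube   : ∀ {l r u} x s {found : True (factorOf? ((x ∷ s) ++ (x ∷ s) ++ (x ∷ s)) (h u))} →
           BadExtensions l r u
  left   : ∀ {l r u} → (∀ a → BadExtensions l r (a ∷ u)) → BadExtensions (suc l) r u
  right  : ∀ {l r u} → (∀ b → BadExtensions l r (u ∷ʳ b)) → BadExtensions l (suc r) u

BadExtensions-sound : ∀ {l r u} → BadExtensions l r u →
                      ∀ c d → length c ≡ l → length d ≡ r → ¬ InL (h (c ++ u ++ d))
BadExtensions-sound (forbid {found = ok}) c d _ _ inL =
  InL⇒¬Forbidden (InL-factor (FactorOf-h (c , d , refl)) inL) (toWitness ok)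
BadExtensions-sound (cube x s {ok}) c d _ _ (cf , _) =
  cf (x ∷ s) (λ ()) (FactorOf-trans (toWitness ok) (FactorOf-h (c , d , refl)))
BadExtensions-sound {suc l} {u = u} (left ext) c d |c| |d| with initLast c
... | []       with () ← |c|
... | c′ ∷ʳ′ a =
  subst (λ z → ¬ InL (h z)) (sym (++-assoc c′ (a ∷ []) (u ++ d)))
        (BadExtensions-sound (ext a) c′ d (suc-injective (trans (sym (length-∷ʳ c′ a)) |c|)) |d|)
BadExtensions-sound {r = suc r} {u} (right ext) c (b ∷ d) |c| |d| =
  subst (λ z → ¬ InL (h (c ++ z))) (++-assoc u (b ∷ []) d)
        (BadExtensions-sound (ext b) c d |c| (suc-injective |d|))

certificates : All (BadExtensions 6 6) F
certificates =
  forbid ∷ forbid ∷ forbid ∷ forbid ∷ extensions-212 ∷ forbid ∷ forbid ∷ extensions-121012 ∷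
  extensions-01021010 ∷ extensions-21021012102 ∷ []
  where
  extensions-212 : BadExtensions 6 6 (a2 ∷ a1 ∷ a2 ∷ [])
  extensions-212 = right λ where
    a0 → forbid
    a1 → forbid
    a2 → forbid

  extensions-121012 : BadExtensions 6 6 (a1 ∷ a2 ∷ a1 ∷ a0 ∷ a1 ∷ a2 ∷ [])
  extensions-121012 = right λ where
    a0 → forbid
    a1 → forbid
    a2 → forbid

  extensions-01021010 : BadExtensions 6 6 (a0 ∷ a1 ∷ a0 ∷ a2 ∷ a1 ∷ a0 ∷ a1 ∷ a0 ∷ [])
  extensions-01021010 = left λ where
    a0 → forbid
    a1 → left λ where
      a0 → forbid
      a1 → forbid
      a2 → right λ where
        a0 → forbid
        a1 → forbid
        a2 → right λ where
          a0 → forbid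
          a1 → right λ where
            a0 → right λ where
              a0 → forbid
              a1 → left λ where
                a0 → cube a0 (a1 ∷ a0 ∷ a2 ∷ a1 ∷ a0 ∷ a1 ∷ a2 ∷ a1 ∷ [])
                a1 → right λ where
                  a0 → cube a1 (a0 ∷ a2 ∷ a1 ∷ a0 ∷ a1 ∷ a2 ∷ a1 ∷ a0 ∷ [])
                  a1 → forbid
                  a2 → cube a1 (a0 ∷ a2 ∷ a1 ∷ a0 ∷ a1 ∷ a2 ∷ a1 ∷ a0 ∷ [])
                a2 → forbid
              a2 → forbid
            a1 → forbid
            a2 → right λ where
              a0 → forbid
              a1 → forbid
              a2 → forbid
          a2 → forbid
    a2 → forbid

  extensions-21021012102 : BadExtensions 6 6 (a2 ∷ a1 ∷ a0 ∷ a2 ∷ a1 ∷ a0 ∷ a1 ∷ a2 ∷ a1 ∷ a0 ∷ a2 ∷ [])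
  extensions-21021012102 = left λ where
    a0 → forbid
    a1 → left λ where
      a0 → left λ where
        a0 → forbid
        a1 → left λ where
          a0 → forbid
          a1 → forbid
          a2 → left λ where
            a0 → left λ where
              a0 → forbid
              a1 → right λ where
                a0 → forbid
                a1 → right λ where
                  a0 → right λ where
                    a0 → forbid
                    a1 → right λ where
                      a0 → cube a2 (a1 ∷ a0 ∷ a1 ∷ a0 ∷ a2 ∷ a1 ∷ a0 ∷ a1 ∷ a2 ∷ a1 ∷ a0 ∷ [])
                      a1 → forbid
                      a2 → cube a2 (a1 ∷ a0 ∷ a1 ∷ a0 ∷ a2 ∷ a1 ∷ a0 ∷ a1 ∷ a2 ∷ a1 ∷ a0 ∷ [])
                    a2 → forbid
                  a1 → forbid
                  a2 → right λ where
                    a0 → forbid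
                    a1 → forbid
                    a2 → forbid
                a2 → forbid
              a2 → forbid
            a1 → forbid
            a2 → forbid
        a2 → forbid
      a1 → forbid
      a2 → forbid
    a2 → forbid

split-suffix : ∀ n (A : Word) → n ≤ length A → ∃[ A₁ ] ∃[ A₂ ] (A ≡ A₁ ++ A₂ × length A₂ ≡ n)
split-suffix n A n≤|A| = take (length A ∸ n) A , drop (length A ∸ n) A ,
  sym (take++drop≡id (length A ∸ n) A) , trans (length-drop (length A ∸ n) A) (m∸[m∸n]≡n n≤|A|)

split-prefix : ∀ n (A : Word) → n ≤ length A → ∃[ A₁ ] ∃[ A₂ ] (A ≡ A₁ ++ A₂ × length A₁ ≡ n)
split-prefix n A n≤|A| =
  take n A , drop n A , sym (take++drop≡id n A) , trans (length-take n A) (m≤n⇒m⊓n≡m n≤|A|)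

-- Six letters of context on each side let h turn every forbidden factor of u into a forbidden
-- factor or a cube of the image.
InL-inner : ∀ c u d → length c ≡ 6 → length d ≡ 6 → InL (h (c ++ u ++ d)) → InL u
InL-inner c u d |c| |d| inL@(cf , _) = cube-free , avoids
  where
  cube-free : CubeFree u
  cube-free s s≢[] sss⊑u = cf (h s) (h-≢[] s≢[])
    (subst (λ z → FactorOf z (h (c ++ u ++ d))) (trans (h-++ s (s ++ s)) (cong (h s ++_) (h-++ s s)))
           (FactorOf-h (FactorOf-trans sss⊑u (c , d , refl))))
  avoids : ∀ f → f ∈ F → ¬ FactorOf f u
  avoids f f∈F (X , Y , refl)
    with A₁ , c₆ , eA , |c₆| ← split-suffix 6 (c ++ X) (subst (_≤ length (c ++ X)) |c| (length-++-≤ˡ c))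
    with d₆ , B₂ , eB , |d₆| ← split-prefix 6 (Y ++ d) (subst (_≤ length (Y ++ d)) |d| (length-++-≤ʳ d {Y}))
    = BadExtensions-sound (lookup certificates f∈F) c₆ d₆ |c₆| |d₆|
        (InL-factor (FactorOf-h (A₁ , B₂ , eq)) inL)
    where
    regroup : ∀ (C X F Y D : Word) → C ++ (X ++ F ++ Y) ++ D ≡ (C ++ X) ++ F ++ (Y ++ D)
    regroup C X F Y D = solve (++-monoid Letter)
    regroup′ : ∀ (A C F D B : Word) → (A ++ C) ++ F ++ (D ++ B) ≡ A ++ (C ++ F ++ D) ++ B
    regroup′ A C F D B = solve (++-monoid Letter)
    eq : c ++ (X ++ f ++ Y) ++ d ≡ A₁ ++ (c₆ ++ f ++ d₆) ++ B₂
    eq = trans (regroup c X f Y d) (trans (cong₂ (λ l r → l ++ f ++ r) eA eB) (regroup′ A₁ c₆ f d₆ B₂))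

∀-length≤? : ∀ {P : Word → Set} → (∀ s → Dec (P s)) → ∀ n → Dec (∀ s → length s ≤ n → P s)
∀-length≤? P? zero = map′ (λ p → λ { [] _ → p }) (λ all → all [] z≤n) (P? [])
∀-length≤? {P} P? (suc n) = map′ to from (P? [] ×-dec all? λ a → ∀-length≤? (λ s → P? (a ∷ s)) n)
  where
  to : P [] × (∀ a s → length s ≤ n → P (a ∷ s)) → ∀ s → length s ≤ suc n → P s
  to (p , _) []      _         = p
  to (_ , q) (a ∷ s) (s≤s |s|≤n) = q a s |s|≤n
  from : (∀ s → length s ≤ suc n → P s) → P [] × (∀ a s → length s ≤ n → P (a ∷ s))
  from all = all [] z≤n , λ a s |s|≤n → all (a ∷ s) (s≤s |s|≤n)

ShortWord : Word → Set
ShortWord s = FactorOf s (H 6) ⊎ Forbidden s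

shortWord? : ∀ s → Dec (ShortWord s)
shortWord? s = factorOf? s (H 6) ⊎-dec forbidden? s

short-words : ∀ s → length s ≤ 5 → ShortWord s
short-words = toWitness {a? = ∀-length≤? shortWord? 5} _

short-InL⇒FactorOfH : ∀ s → length s ≤ 5 → InL s → FactorOfH s
short-InL⇒FactorOfH s |s|≤5 inL =
  [ (λ s⊑H₆ → 6 , s⊑H₆) , (λ fw → ⊥-elim (InL⇒¬Forbidden inL fw)) ]′ (short-words s |s|≤5)

-- Desubstitution

EventuallyInL : InfWord → ℕ → Set
EventuallyInL x C = ∀ w i → C ≤ i → OccursAt w x i → InL w

skip : Letter → ℕ
skip a1 = 1
skip _  = 0

blockLength : Letter → ℕ
blockLength a1 = 2
blockLength _  = 1

blockLength≥1 : ∀ a → 1 ≤ blockLength a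
blockLength≥1 a0 = s≤s z≤n
blockLength≥1 a1 = s≤s z≤n
blockLength≥1 a2 = s≤s z≤n

blockLength≤2 : ∀ a → blockLength a ≤ 2
blockLength≤2 a0 = s≤s z≤n
blockLength≤2 a1 = ≤-refl
blockLength≤2 a2 = s≤s z≤n

decode : Letter → Letter → Letter
decode a0 a1 = a0
decode a0 _  = a2
decode _  _  = a1

-- From position C on, skipping a leading 1, x is cut into blocks 01, 21 and 0 (the images of
-- 0, 1 and 2): block k starts at start k, is two letters long iff its second letter is 1, and
-- is the image of y k.
module Desubstitution (x : InfWord) (C : ℕ) (ev : EventuallyInL x C) where

  start : ℕ → ℕ
  start zero    = skip (x C) + C
  start (suc k) = blockLength (x (suc (start k))) + start k

  y : InfWord
  y k = decode (x (start k)) (x (suc (start k)))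

  C≤start : ∀ k → C ≤ start k
  C≤start zero    = m≤n+m C (skip (x C))
  C≤start (suc k) = ≤-trans (C≤start k) (m≤n+m (start k) _)

  forbidden-pair : ∀ i → C ≤ i → ∀ a b {ab∈F : True ((a ∷ b ∷ []) ∈? F)} → x i ≡ a → x (suc i) ≡ b → ⊥
  forbidden-pair i C≤i a b {ab∈F} refl refl =
    InL⇒¬Forbidden (ev _ i C≤i refl) (forbidden (a ∷ b ∷ []) {ab∈F} (FactorOf-refl _))

  start-≢1 : ∀ k → x (start k) ≢ a1
  start-≢1 zero with x C in e
  ... | a0 = λ e′ → case trans (sym e) e′ of λ ()
  ... | a2 = λ e′ → case trans (sym e) e′ of λ ()
  ... | a1 = forbidden-pair C ≤-refl a1 a1 e
  start-≢1 (suc k) with x (suc (start k)) in e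
  ... | a0 = λ e′ → case trans (sym e) e′ of λ ()
  ... | a2 = λ e′ → case trans (sym e) e′ of λ ()
  ... | a1 = forbidden-pair (suc (start k)) (≤-trans (C≤start k) (n≤1+n _)) a1 a1 e

  block : ∀ k → slice x (start k) (blockLength (x (suc (start k)))) ≡ hL (y k)
  block k with x (start k) in e₁ | x (suc (start k)) in e₂
  ... | a0 | a0 = cong (_∷ []) e₁
  ... | a0 | a2 = cong (_∷ []) e₁
  ... | a0 | a1 = cong₂ (λ a b → a ∷ b ∷ []) e₁ e₂
  ... | a2 | a1 = cong₂ (λ a b → a ∷ b ∷ []) e₁ e₂
  ... | a1 | _  = ⊥-elim (start-≢1 k e₁)
  ... | a2 | a0 = ⊥-elim (forbidden-pair (start k) (C≤start k) a2 a0 e₁ e₂)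
  ... | a2 | a2 = ⊥-elim (forbidden-pair (start k) (C≤start k) a2 a2 e₁ e₂)

  blockLength-y : ∀ k → length (hL (y k)) ≡ blockLength (x (suc (start k)))
  blockLength-y k = trans (cong length (sym (block k))) (length-slice x (start k) _)

  image-slice : ∀ m k → slice x (start k) (length (h (slice y k m))) ≡ h (slice y k m)
                      × start (m + k) ≡ length (h (slice y k m)) + start k
  image-slice zero    k = refl , refl
  image-slice (suc m) k with ih₁ , ih₂ ← image-slice m (suc k) = occurs , ends
    where
    A = hL (y k)
    B = h (slice y (suc k) m)
    start-suc : start (suc k) ≡ length A + start k
    start-suc = cong (_+ start k) (sym (blockLength-y k))
    occurs : slice x (start k) (length (A ++ B)) ≡ A ++ B
    occurs = begin
      slice x (start k) (length (A ++ B))                               ≡⟨ cong (slice x (start k)) (length-++ A) ⟩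
      slice x (start k) (length A + length B)                           ≡⟨ slice-++ x (start k) (length A) (length B) ⟩
      slice x (start k) (length A) ++ slice x (length A + start k) (length B)
        ≡⟨ cong₂ _++_ (trans (cong (slice x (start k)) (blockLength-y k)) (block k))
                      (cong (λ i → slice x i (length B)) (sym start-suc)) ⟩
      A ++ slice x (start (suc k)) (length B)                           ≡⟨ cong (A ++_) ih₁ ⟩
      A ++ B                                                            ∎
      where open ≡-Reasoning
    ends : start (suc m + k) ≡ length (A ++ B) + start k
    ends = begin
      start (suc (m + k))                 ≡⟨ cong start (sym (+-suc m k)) ⟩
      start (m + suc k)                   ≡⟨ ih₂ ⟩
      length B + start (suc k)            ≡⟨ cong (length B +_) start-suc ⟩
      length B + (length A + start k)     ≡⟨ rearrange (length A) (length B) (start k) ⟩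
      (length A + length B) + start k     ≡⟨ cong (_+ start k) (sym (length-++ A)) ⟩
      length (A ++ B) + start k           ∎
      where
      open ≡-Reasoning
      rearrange : ∀ a b s → b + (a + s) ≡ (a + b) + s
      rearrange = solve-∀

  start-step : ∀ k → suc (start k) ≤ start (suc k)
  start-step k = +-monoˡ-≤ (start k) (blockLength≥1 (x (suc (start k))))

  start-step≤2 : ∀ k → start (suc k) ≤ 2 + start k
  start-step≤2 k = +-monoˡ-≤ (start k) (blockLength≤2 (x (suc (start k))))

  start-+ : ∀ n k → n + start k ≤ start (n + k)
  start-+ zero    k = ≤-refl
  start-+ (suc n) k = ≤-trans (s≤s (start-+ n k)) (start-step (n + k))

  -- Two consecutive one-letter blocks would create one of the forbidden factors 00, 20, 22.
  start-+2 : ∀ k → 3 + start k ≤ start (2 + k)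
  start-+2 k with x (start k) in e₁ | x (suc (start k)) in e₂
  ... | _  | a1 = +-monoˡ-≤ (2 + start k) (blockLength≥1 _)
  ... | a1 | _  = ⊥-elim (start-≢1 k e₁)
  ... | a0 | a0 = ⊥-elim (forbidden-pair (start k) (C≤start k) a0 a0 e₁ e₂)
  ... | a2 | a0 = ⊥-elim (forbidden-pair (start k) (C≤start k) a2 a0 e₁ e₂)
  ... | a2 | a2 = ⊥-elim (forbidden-pair (start k) (C≤start k) a2 a2 e₁ e₂)
  ... | a0 | a2 with x (suc (suc (start k))) in e₃
  ...   | a1 = ≤-refl
  ...   | a0 = ⊥-elim (forbidden-pair (suc (start k)) (≤-trans (C≤start k) (n≤1+n _)) a2 a0 e₂ e₃)
  ...   | a2 = ⊥-elim (forbidden-pair (suc (start k)) (≤-trans (C≤start k) (n≤1+n _)) a2 a2 e₂ e₃)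

  k≤start : ∀ k → k ≤ start k
  k≤start zero    = z≤n
  k≤start (suc k) = ≤-trans (s≤s (k≤start k)) (start-step k)

  start-mono : ∀ {m n} → m ≤ n → start m ≤ start n
  start-mono {m} {n} m≤n = ≤-trans (m≤n+m (start m) (n ∸ m))
    (subst (λ k → n ∸ m + start m ≤ start k) (m∸n+n≡m m≤n) (start-+ (n ∸ m) m))

  start-gap : ∀ m k → 4 ≤ m → 2 + start k + m ≤ start (m + k)
  start-gap (suc (suc (suc (suc m)))) k (s≤s (s≤s (s≤s (s≤s _)))) = begin
    2 + start k + (4 + m)      ≡⟨ rearrange (start k) m ⟩
    m + (3 + (3 + start k))    ≤⟨ +-monoʳ-≤ m (≤-trans (+-monoʳ-≤ 3 (start-+2 k)) (start-+2 (2 + k))) ⟩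
    m + start (4 + k)          ≤⟨ start-+ m (4 + k) ⟩
    start (m + (4 + k))        ≡⟨ cong start (+-suc-4 m k) ⟩
    start (4 + m + k)          ∎
    where
    open ≤-Reasoning hiding (start)
    rearrange : ∀ s m → 2 + s + (4 + m) ≡ m + (3 + (3 + s))
    rearrange = solve-∀
    +-suc-4 : ∀ m k → m + (4 + k) ≡ 4 + m + k
    +-suc-4 = solve-∀

  block-containing : ∀ i → start 0 ≤ i → ∃[ j ] (start j ≤ i × i < start (suc j))
  block-containing i start₀≤i = search (suc i) (≤-trans (s≤s (k≤start i)) (start-step i))
    where
    search : ∀ t → i < start t → ∃[ j ] (start j ≤ i × i < start (suc j))
    search zero    i<start₀ = ⊥-elim (<⇒≱ i<start₀ start₀≤i)
    search (suc t) i<start with start t ≤? i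
    ... | yes start≤i = t , start≤i , i<start
    ... | no  start≰i = search t (≰⇒> start≰i)

  cover : ∀ s i j → start j ≤ i → i < start (suc j) → OccursAt s x i → 5 ≤ length s →
          FactorOf s (h (slice y j (pred (length s))))
  cover s i j j≤i i<start occ 5≤|s| with length s | occ
  ... | suc m | refl = subst (FactorOf (slice x i (suc m))) (proj₁ (image-slice m j))
                             (slice-factor x (start j) L i (suc m) j≤i bound)
    where
    L = length (h (slice y j m))
    bound : i + suc m ≤ start j + L
    bound = begin
      i + suc m              ≤⟨ +-monoˡ-≤ (suc m) (≤-pred (≤-trans i<start (start-step≤2 j))) ⟩
      suc (start j) + suc m  ≡⟨ rearrange (start j) m ⟩
      2 + start j + m        ≤⟨ start-gap m j (≤-pred 5≤|s|) ⟩
      start (m + j)          ≡⟨ proj₂ (image-slice m j) ⟩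
      L + start j            ≡⟨ +-comm L (start j) ⟩
      start j + L            ∎
      where
      open ≤-Reasoning hiding (start)
      rearrange : ∀ s m → suc s + suc m ≡ 2 + s + m
      rearrange = solve-∀

  y-eventually-InL : EventuallyInL y 6
  y-eventually-InL u j 6≤j occ = InL-inner c u d (length-slice y j₀ 6) (length-slice y (length u + j) 6)
    (subst (λ w → InL (h w)) W≡cud (ev (h W) (start j₀) (C≤start j₀) (proj₁ (image-slice M j₀))))
    where
    j₀ = j ∸ 6
    c = slice y j₀ 6
    d = slice y (length u + j) 6
    M = 6 + (length u + 6)
    W = slice y j₀ M
    W≡cud : W ≡ c ++ u ++ d
    W≡cud = begin
      W                                           ≡⟨ slice-++ y j₀ 6 (length u + 6) ⟩
      c ++ slice y (6 + j₀) (length u + 6)        ≡⟨ cong (λ i → c ++ slice y i (length u + 6)) (trans (+-comm 6 j₀) (m∸n+n≡m 6≤j)) ⟩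
      c ++ slice y j (length u + 6)               ≡⟨ cong (c ++_) (slice-++ y j (length u) 6) ⟩
      c ++ slice y j (length u) ++ d              ≡⟨ cong (λ v → c ++ v ++ d) occ ⟩
      c ++ u ++ d                                 ∎
      where open ≡-Reasoning

  start-reflects : ∀ {M i j} → start M < i → i < start (suc j) → M ≤ j
  start-reflects {M} {i} {j} M<i i<j with M ≤? j
  ... | yes M≤j = M≤j
  ... | no  M≰j = ⊥-elim (<⇒≱ i<j (≤-trans (start-mono (≰⇒> M≰j)) (<⇒≤ M<i)))

Recurs : (Word → Set) → Set → InfWord → Set
Recurs P Q x = ∀ N → Q ⊎ ∃[ i ] (N ≤ i × ∃[ s ] (P s × OccursAt s x i))

-- The goal Q is arbitrary so that the argument stays constructive: recurrence is only ever used
-- to produce one occurrence beyond a given position, and an occurrence of a short word already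
-- yields Q.
recurrent⇒FactorOfH : ∀ n x C → EventuallyInL x C → (P : Word → Set) (Q : Set) →
                      (∀ s → P s → length s ≤ n) → Recurs P Q x → (∀ s → P s → FactorOfH s → Q) → Q
recurrent⇒FactorOfH zero x C ev P Q |P|≤0 rec found with rec C
... | inj₁ q = q
... | inj₂ (i , C≤i , s , ps , occ) =
  found s ps (short-InL⇒FactorOfH s (≤-trans (|P|≤0 s ps) z≤n) (ev s i C≤i occ))
recurrent⇒FactorOfH (suc n) x C ev P Q |P|≤n+1 rec found =
  recurrent⇒FactorOfH n y 6 y-eventually-InL P′ Q |P′|≤n rec′ found′
  where
  open Desubstitution x C ev
  P′ : Word → Set
  P′ v = ∃[ s ] (P s × FactorOf s (h v) × length v < length s)
  |P′|≤n : ∀ v → P′ v → length v ≤ n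
  |P′|≤n v (s , ps , _ , |v|<|s|) = ≤-pred (≤-trans |v|<|s| (|P|≤n+1 s ps))
  found′ : ∀ v → P′ v → FactorOfH v → Q
  found′ v (s , ps , s⊑hv , _) (k , v⊑Hk) = found s ps (suc k , FactorOf-trans s⊑hv (FactorOf-h v⊑Hk))
  rec′ : Recurs P′ Q y
  rec′ M with rec (suc (start M))
  ... | inj₁ q = inj₁ q
  ... | inj₂ (i , M<i , s , ps , occ) with 5 ≤? length s
  ...   | no 5≰|s| = inj₁ (found s ps (short-InL⇒FactorOfH s (<⇒≤ (≰⇒> 5≰|s|))
                                          (ev s i (≤-trans (C≤start M) (<⇒≤ M<i)) occ)))
  ...   | yes 5≤|s| with j , j≤i , i<j ← block-containing i (≤-trans (start-mono {n = M} z≤n) (<⇒≤ M<i)) =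
    inj₂ (j , start-reflects M<i i<j , slice y j (pred (length s)) ,
          (s , ps , cover s i j j≤i i<j occ 5≤|s| , subst (_< length s) (sym (length-slice y j _)) (pred< 5≤|s|)) ,
          cong (slice y j) (length-slice y j _))
    where
    pred< : ∀ {m n} → suc m ≤ n → pred n < n
    pred< (s≤s _) = ≤-refl

theorem13 : (∀ w → Factor w p → InL w)
    × (∀ (x : InfWord) → (∀ w → Factor w x → InL w)
         → ∀ w → Recurrent w x → Factor w p)
theorem13 = factors-in-L , recurrent-factors
  where
  factors-in-L : ∀ w → Factor w p → InL w
  factors-in-L w occ with k , w⊑Hk ← Factor⇒FactorOfH occ = FactorOf-H⇒InL k w⊑Hk
  recurrent-factors : ∀ x → (∀ w → Factor w x → InL w) → ∀ w → Recurrent w x → Factor w p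
  recurrent-factors x inL w rec = FactorOfH⇒Factor
    (recurrent⇒FactorOfH (length w) x 0 (λ u i _ occ → inL u (i , occ)) (_≡ w) (FactorOfH w)
       (λ { s refl → ≤-refl })
       (λ N → let i , N≤i , occ = rec N in inj₂ (i , N≤i , w , refl , occ))
       (λ { s refl w⊑H → w⊑H }))
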